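{- For every integer $n\geq 3$, the $(n-1)$-th Lucas number $\ell_{n-1}$ equals the number of perfect matchings of the Cartesian product graph $P_2\times T_n$.
   Context: $P_2$ is the path with two vertices. $T_n$ is the caterpillar with vertex set $\{1,\dots,n\}$ and edges $\{1,3\}$, $\{2,3\}$, and $\{i,i+1\}$ for $3\leq i\leq n-1$ (a path $2,3,4,\dots,n$ with an extra pendant vertex $1$ attached to vertex $3$). $P_2\times T_n$ is the Cartesian product of graphs. Lucas numbers: $\ell_1=1,\ell_2=3$, $\ell_k=\ell_{k-1}+\ell_{k-2}$. -}

module Defs where

open import Data.Nat using (ℕ; zero; suc; _+_; _*_; _≤_)
open import Data.Fin using (Fin; toℕ)
open import Data.Fin.Properties using (_≟_)
open import Data.Vec using (Vec; []; _∷_; lookup)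
open import Data.List using (List; []; _∷_; map; concatMap; length; filter)
open import Data.List.Base using (allFin)
open import Data.Product using (_×_; _,_; proj₁; proj₂)
open import Data.Sum using (_⊎_)
open import Relation.Nullary using (¬_; Dec)
open import Relation.Binary.PropositionalEquality using (_≡_)
open import Relation.Unary using (Decidable)

-- Lucas numbers as in the paper: ℓ₁ = 1, ℓ₂ = 3, ℓₖ = ℓₖ₋₁ + ℓₖ₋₂
-- (ℓ₀ = 2 is the usual convention; it is only used to make the function total).
lucas : ℕ → ℕ
lucas zero = 2
lucas (suc zero) = 1
lucas (suc (suc k)) = lucas (suc k) + lucas k

record Graph (V : ℕ) : Set₁ where
  field
    Adj      : Fin V → Fin V → Set
    adj?     : (u v : Fin V) → Dec (Adj u v)
    symm     : ∀ {u v} → Adj u v → Adj v u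
    irrefl   : ∀ {u} → ¬ Adj u u
open Graph public

-- A perfect matching of G, represented by its "partner" map m (stored as
-- a vector, m[v] = the vertex matched with v): every vertex is matched to
-- an adjacent vertex and the matching is symmetric (m[m[v]] = v).
-- Such partner maps are in bijection with perfect matchings (edge sets).
IsPerfectMatching : ∀ {V} → Graph V → Vec (Fin V) V → Set
IsPerfectMatching {V} G m =
  (v : Fin V) → Adj G v (lookup m v) × lookup m (lookup m v) ≡ v

allVecs : (V k : ℕ) → List (Vec (Fin V) k)
allVecs V zero = [] ∷ []
allVecs V (suc k) = concatMap (λ x → map (x ∷_) (allVecs V k)) (allFin V)

open import Data.Fin.Properties using (all?)
open import Relation.Nullary.Decidable using (_×-dec_)

isPM? : ∀ {V} (G : Graph V) → Decidable (IsPerfectMatching G)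
isPM? {V} G m = all? (λ v → adj? G v (lookup m v) ×-dec (lookup m (lookup m v) ≟ v))

numPerfectMatchings : ∀ {V} → Graph V → ℕ
numPerfectMatchings {V} G = length (filter (isPM? G) (allVecs V V))

-- Cartesian product of graphs, on vertex set Fin (V * W) via the standard
-- encoding Fin V × Fin W ≃ Fin (V * W) (Data.Fin.combine / remQuot).
open import Data.Fin using (combine; remQuot)
open import Data.Fin.Properties using (remQuot-combine; combine-remQuot)
open import Data.Sum using (inj₁; inj₂; [_,_])
open import Relation.Nullary.Decidable using (_⊎-dec_)
open import Relation.Binary.PropositionalEquality using (sym; refl; cong)

CartAdj : ∀ {V W} → Graph V → Graph W → Fin V × Fin W → Fin V × Fin W → Set
CartAdj G H (a , x) (b , y) = (a ≡ b × Adj H x y) ⊎ (Adj G a b × x ≡ y)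

_□_ : ∀ {V W} → Graph V → Graph W → Graph (V * W)
_□_ {V} {W} G H = record
  { Adj    = λ u v → CartAdj G H (remQuot W u) (remQuot W v)
  ; adj?   = λ u v → dec (remQuot W u) (remQuot W v)
  ; symm   = λ {u} {v} → sy (remQuot W u) (remQuot W v)
  ; irrefl = λ {u} → ir (remQuot W u)
  }
  where
  dec : ∀ p q → Dec (CartAdj G H p q)
  dec (a , x) (b , y) = ((a ≟ b) ×-dec adj? H x y) ⊎-dec (adj? G a b ×-dec (x ≟ y))
  sy : ∀ p q → CartAdj G H p q → CartAdj G H q p
  sy (a , x) (b , y) (inj₁ (e , h)) = inj₁ (sym e , symm H h)
  sy (a , x) (b , y) (inj₂ (g , e)) = inj₂ (symm G g , sym e)
  ir : ∀ p → ¬ CartAdj G H p p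
  ir (a , x) (inj₁ (_ , h)) = irrefl H h
  ir (a , x) (inj₂ (g , _)) = irrefl G g

open import Data.Nat using (_<_)
open import Data.Nat.Properties using (_≤?_; <-irrefl) renaming (_≟_ to _≟ℕ_)
open import Data.Empty using (⊥)

SymAdj : (ℕ → ℕ → Set) → ℕ → ℕ → Set
SymAdj E i j = E i j ⊎ E j i

P2Edge : ℕ → ℕ → Set
P2Edge i j = i ≡ 0 × j ≡ 1

-- T_n (paper labels 1..n, here 0..n-1 via label k ↦ k-1):
-- edges {1,3},{2,3},{i,i+1} (3 ≤ i ≤ n-1) become
-- {0,2},{1,2},{i,i+1} (2 ≤ i, i+1 ≤ n-1).
TEdge : ℕ → ℕ → ℕ → Set
TEdge n i j = (i ≡ 0 × j ≡ 2) ⊎ (i ≡ 1 × j ≡ 2) ⊎ (2 ≤ i × j ≡ suc i × j < n)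

P2Edge? : ∀ i j → Dec (P2Edge i j)
P2Edge? i j = (i ≟ℕ 0) ×-dec (j ≟ℕ 1)

TEdge? : ∀ n i j → Dec (TEdge n i j)
TEdge? n i j = ((i ≟ℕ 0) ×-dec (j ≟ℕ 2)) ⊎-dec (((i ≟ℕ 1) ×-dec (j ≟ℕ 2))
               ⊎-dec ((2 ≤? i) ×-dec ((j ≟ℕ suc i) ×-dec (suc j ≤? n))))

P2-irr : ∀ i → ¬ P2Edge i i
P2-irr .0 (refl , ())

T-irr : ∀ n i → ¬ TEdge n i i
T-irr n .0 (inj₁ (refl , ()))
T-irr n .1 (inj₂ (inj₁ (refl , ())))
T-irr n i (inj₂ (inj₂ (_ , e , _))) = n≢sn e
  where
  n≢sn : ∀ {k} → ¬ k ≡ suc k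
  n≢sn ()

mkGraph : (V : ℕ) (E : ℕ → ℕ → Set) → (∀ i j → Dec (E i j)) → (∀ i → ¬ E i i) → Graph V
mkGraph V E E? irr = record
  { Adj    = λ u v → SymAdj E (toℕ u) (toℕ v)
  ; adj?   = λ u v → E? (toℕ u) (toℕ v) ⊎-dec E? (toℕ v) (toℕ u)
  ; symm   = λ { (inj₁ e) → inj₂ e ; (inj₂ e) → inj₁ e }
  ; irrefl = λ { (inj₁ e) → irr _ e ; (inj₂ e) → irr _ e }
  }

P₂ : Graph 2
P₂ = mkGraph 2 P2Edge P2Edge? P2-irr

T : (n : ℕ) → Graph n
T n = mkGraph n (TEdge n) (TEdge? n) (T-irr n)

-- A perfect matching of P₂ □ T n, n = 3 + m, either matches both pendant columns 0 and 1
-- vertically, leaving the 2 × (m + 1) ladder on columns 2, …, n − 1, or matches one of them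
-- horizontally into column 2 and the other vertically, leaving the 2 × m ladder on columns
-- 3, …, n − 1. Perfect matchings of a 2 × w ladder are its domino tilings, and there are
-- F(w + 1) of them, so P₂ □ T n has F(m + 2) + 2 F(m + 1) = ℓ(m + 2) perfect matchings.

{-# OPTIONS --safe #-}
module Submission where

open import Defs
open import Data.Nat using (ℕ; zero; suc; _+_; _*_; _≤_; _<_; _∸_; z≤n; s≤s; NonZero)
open import Data.Nat.Properties
  using (+-suc; +-assoc; +-comm; +-identityʳ; +-cancelˡ-≡; +-monoʳ-<; ≤-refl; ≤-trans; <-irrefl; m≤m+n; m<m+n;
         m≤n⇒m≤1+n; n<1+n; 1+n≰n; <⇒≱; ≤⇒≯; ≮⇒≥; m<n⇒m<1+n; m<1+n⇒m<n∨m≡n)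
open import Data.Nat.DivMod using (_mod_; m<n⇒m%n≡m)
open import Data.Fin using (Fin; zero; suc; toℕ; opposite; combine; remQuot)
open import Data.Fin.Properties
  using (opposite-involutive; toℕ-injective; toℕ<n; toℕ-fromℕ<; remQuot-combine; combine-remQuot)
open import Data.Vec using (Vec; []; _∷_; lookup; tabulate)
open import Data.Vec.Properties using (lookup∘tabulate; tabulate∘lookup; tabulate-cong; ∷-injective)
open import Data.List using (List; []; _∷_; _++_; map; concatMap; cartesianProductWith; length; filter; allFin)
open import Data.List.Properties using (length-++; length-map)
open import Data.List.Membership.Propositional using (_∈_)
open import Data.List.Membership.Propositional.Properties
  using (∈-map⁺; ∈-map⁻; ∈-++⁺ˡ; ∈-++⁺ʳ; ∈-++⁻; ∈-filter⁺; ∈-filter⁻; ∈-allFin; ∈-cartesianProductWith⁺)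
open import Data.List.Membership.Propositional.Properties.WithK using (unique∧set⇒bag)
open import Data.List.Relation.Binary.BagAndSetEquality using (∼bag⇒↭)
open import Data.List.Relation.Binary.Permutation.Propositional.Properties using (↭-length)
open import Data.List.Relation.Binary.Disjoint.Propositional using (Disjoint)
open import Data.List.Relation.Unary.Any using (here)
open import Data.List.Relation.Unary.All using ([])
open import Data.List.Relation.Unary.AllPairs using ([]; _∷_)
open import Data.List.Relation.Unary.Unique.Propositional using (Unique)
import Data.List.Relation.Unary.Unique.Propositional.Properties as Unique
open import Data.Product using (Σ; _×_; _,_; proj₁; proj₂; uncurry; map₂)
open import Data.Sum using (_⊎_; inj₁; inj₂; [_,_])
open import Data.Empty using (⊥-elim)
open import Function using (_∘_)
open import Function.Bundles using (mk⇔)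
open import Relation.Unary using (Decidable)
open import Relation.Binary.PropositionalEquality
  using (_≡_; _≢_; refl; sym; trans; cong; cong₂; subst; module ≡-Reasoning)
open import Data.Nat.Tactic.RingSolver using (solve-∀)

open ≡-Reasoning

length-filter≡length : ∀ {A : Set} {P : A → Set} (P? : Decidable P) {xs ys : List A} →
  Unique xs → (∀ x → x ∈ xs) → Unique ys → (∀ y → P y → y ∈ ys) → (∀ y → y ∈ ys → P y) →
  length (filter P? xs) ≡ length ys
length-filter≡length P? {xs} xs-unique xs-complete ys-unique P⇒∈ ∈⇒P =
  ↭-length (∼bag⇒↭ (unique∧set⇒bag (Unique.filter⁺ P? xs-unique) ys-unique (mk⇔
    (λ y∈ → P⇒∈ _ (proj₂ (∈-filter⁻ P? {xs = xs} y∈)))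
    (λ y∈ → ∈-filter⁺ P? (xs-complete _) (∈⇒P _ y∈)))))

map-disjoint : ∀ {A B C : Set} {f : A → C} {g : B → C} {xs ys} →
  (∀ a b → f a ≢ g b) → Disjoint (map f xs) (map g ys)
map-disjoint {f = f} {g} {xs} {ys} f≢g (v∈fxs , v∈gys)
  with ∈-map⁻ f {xs = xs} v∈fxs | ∈-map⁻ g {xs = ys} v∈gys
... | a , _ , refl | b , _ , fa≡gb = f≢g a b fa≡gb

++-disjointʳ : ∀ {A : Set} {xs ys zs : List A} → Disjoint xs ys → Disjoint xs zs → Disjoint xs (ys ++ zs)
++-disjointʳ {ys = ys} xs#ys xs#zs (v∈xs , v∈ys++zs) =
  [ (λ v∈ys → xs#ys (v∈xs , v∈ys)) , (λ v∈zs → xs#zs (v∈xs , v∈zs)) ] (∈-++⁻ ys v∈ys++zs)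

concatMap≡cartesianProductWith : ∀ {A B C : Set} (f : A → B → C) xs ys →
  concatMap (λ x → map (f x) ys) xs ≡ cartesianProductWith f xs ys
concatMap≡cartesianProductWith f [] ys = refl
concatMap≡cartesianProductWith f (x ∷ xs) ys =
  cong (map (f x) ys ++_) (concatMap≡cartesianProductWith f xs ys)

allVecs-unique : ∀ V k → Unique (allVecs V k)
allVecs-unique V zero = [] ∷ []
allVecs-unique V (suc k) =
  subst Unique (sym (concatMap≡cartesianProductWith _∷_ (allFin V) (allVecs V k)))
    (Unique.cartesianProductWith⁺ _∷_ ∷-injective (Unique.allFin⁺ V) (allVecs-unique V k))

∈-allVecs : ∀ V k (v : Vec (Fin V) k) → v ∈ allVecs V k
∈-allVecs V zero [] = here refl
∈-allVecs V (suc k) (x ∷ v) =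
  subst (x ∷ v ∈_) (sym (concatMap≡cartesianProductWith _∷_ (allFin V) (allVecs V k)))
    (∈-cartesianProductWith⁺ _∷_ (∈-allFin x) (∈-allVecs V k v))

IsPartnerMap : ∀ {V W} → Graph V → Graph W → (Fin V × Fin W → Fin V × Fin W) → Set
IsPartnerMap G H μ = ∀ p → CartAdj G H p (μ p) × μ (μ p) ≡ p

module _ {V W : ℕ} where

  toPair : Fin (V * W) → Fin V × Fin W
  toPair = remQuot W

  fromPair : Fin V × Fin W → Fin (V * W)
  fromPair = uncurry combine

  toPair∘fromPair : ∀ p → toPair (fromPair p) ≡ p
  toPair∘fromPair (a , x) = remQuot-combine a x

  fromPair∘toPair : ∀ u → fromPair (toPair u) ≡ u
  fromPair∘toPair = combine-remQuot {V} W

  partnerVec : (Fin V × Fin W → Fin V × Fin W) → Vec (Fin (V * W)) (V * W)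
  partnerVec μ = tabulate (fromPair ∘ μ ∘ toPair)

  partnerMap : Vec (Fin (V * W)) (V * W) → Fin V × Fin W → Fin V × Fin W
  partnerMap v = toPair ∘ lookup v ∘ fromPair

  toPair∘lookup-partnerVec : ∀ μ u → toPair (lookup (partnerVec μ) u) ≡ μ (toPair u)
  toPair∘lookup-partnerVec μ u =
    trans (cong toPair (lookup∘tabulate _ u)) (toPair∘fromPair (μ (toPair u)))

  partnerMap∘partnerVec : ∀ μ p → partnerMap (partnerVec μ) p ≡ μ p
  partnerMap∘partnerVec μ p =
    trans (toPair∘lookup-partnerVec μ (fromPair p)) (cong μ (toPair∘fromPair p))

  partnerVec∘partnerMap : ∀ v → partnerVec (partnerMap v) ≡ v
  partnerVec∘partnerMap v = trans (tabulate-cong λ u → begin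
      fromPair (toPair (lookup v (fromPair (toPair u)))) ≡⟨ fromPair∘toPair _ ⟩
      lookup v (fromPair (toPair u))                      ≡⟨ cong (lookup v) (fromPair∘toPair u) ⟩
      lookup v u                                          ∎)
    (tabulate∘lookup v)

  partnerVec-cong : ∀ {μ ν} → (∀ p → μ p ≡ ν p) → partnerVec μ ≡ partnerVec ν
  partnerVec-cong μ≗ν = tabulate-cong (cong fromPair ∘ μ≗ν ∘ toPair)

  module _ (G : Graph V) (H : Graph W) where

    partnerVec-isPerfectMatching : ∀ {μ} → IsPartnerMap G H μ → IsPerfectMatching (G □ H) (partnerVec μ)
    partnerVec-isPerfectMatching {μ} partner u =
      subst (CartAdj G H (toPair u)) (sym (toPair∘lookup-partnerVec μ u)) (proj₁ (partner (toPair u))) ,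
      (begin
        lookup (partnerVec μ) (lookup (partnerVec μ) u)  ≡⟨ lookup∘tabulate (fromPair ∘ μ ∘ toPair) _ ⟩
        fromPair (μ (toPair (lookup (partnerVec μ) u)))  ≡⟨ cong (fromPair ∘ μ) (toPair∘lookup-partnerVec μ u) ⟩
        fromPair (μ (μ (toPair u)))                      ≡⟨ cong fromPair (proj₂ (partner (toPair u))) ⟩
        fromPair (toPair u)                              ≡⟨ fromPair∘toPair u ⟩
        u                                                ∎)

    partnerMap-isPartnerMap : ∀ {v} → IsPerfectMatching (G □ H) v → IsPartnerMap G H (partnerMap v)
    partnerMap-isPartnerMap {v} perfect p =
      subst (λ q → CartAdj G H q (partnerMap v p)) (toPair∘fromPair p) (proj₁ (perfect (fromPair p))) ,
      (begin
        toPair (lookup v (fromPair (toPair (lookup v (fromPair p)))))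
          ≡⟨ cong (toPair ∘ lookup v) (fromPair∘toPair _) ⟩
        toPair (lookup v (lookup v (fromPair p)))
          ≡⟨ cong toPair (proj₂ (perfect (fromPair p))) ⟩
        toPair (fromPair p)
          ≡⟨ toPair∘fromPair p ⟩
        p ∎)

fib : ℕ → ℕ
fib zero = 0
fib (suc zero) = 1
fib (suc (suc k)) = fib (suc k) + fib k

lucas-suc : ∀ k → lucas (suc k) ≡ fib (suc k) + 2 * fib k
lucas-suc zero = refl
lucas-suc (suc zero) = refl
lucas-suc (suc (suc k)) =
  trans (cong₂ _+_ (lucas-suc (suc k)) (lucas-suc k)) (regroup (fib (suc k)) (fib k))
  where
    regroup : ∀ b c → ((b + c) + 2 * b) + (b + 2 * c) ≡ ((b + c) + b) + 2 * (b + c)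
    regroup = solve-∀

-- Domino tilings of the 2 × w ladder

-- Read from the left: `vert` lays one vertical domino, `horiz` two stacked horizontal ones.
data Tiling : ℕ → Set where
  []    : Tiling 0
  vert  : ∀ {w} → Tiling w → Tiling (suc w)
  horiz : ∀ {w} → Tiling w → Tiling (suc (suc w))

allTilings : ∀ w → List (Tiling w)
allTilings zero = [] ∷ []
allTilings (suc zero) = vert [] ∷ []
allTilings (suc (suc w)) = map vert (allTilings (suc w)) ++ map horiz (allTilings w)

∈-allTilings : ∀ {w} (t : Tiling w) → t ∈ allTilings w
∈-allTilings [] = here refl
∈-allTilings (vert {zero} []) = here refl
∈-allTilings (vert {suc w} t) = ∈-++⁺ˡ (∈-map⁺ vert (∈-allTilings t))
∈-allTilings (horiz {w} t) = ∈-++⁺ʳ (map vert (allTilings (suc w))) (∈-map⁺ horiz (∈-allTilings t))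

allTilings-unique : ∀ w → Unique (allTilings w)
allTilings-unique zero = [] ∷ []
allTilings-unique (suc zero) = [] ∷ []
allTilings-unique (suc (suc w)) =
  Unique.++⁺ (Unique.map⁺ (λ { refl → refl }) (allTilings-unique (suc w)))
             (Unique.map⁺ (λ { refl → refl }) (allTilings-unique w))
             (map-disjoint λ _ _ ())

length-allTilings : ∀ w → length (allTilings w) ≡ fib (suc w)
length-allTilings zero = refl
length-allTilings (suc zero) = refl
length-allTilings (suc (suc w)) = begin
  length (map vert (allTilings (suc w)) ++ map horiz (allTilings w))
    ≡⟨ length-++ (map vert (allTilings (suc w))) ⟩
  length (map vert (allTilings (suc w))) + length (map horiz (allTilings w))
    ≡⟨ cong₂ _+_ (length-map vert (allTilings (suc w))) (length-map horiz (allTilings w)) ⟩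
  length (allTilings (suc w)) + length (allTilings w)
    ≡⟨ cong₂ _+_ (length-allTilings (suc w)) (length-allTilings w) ⟩
  fib (suc (suc (suc w))) ∎

-- (row, column); columns live in ℕ so that shifting a ladder along T n needs no bound proofs.
Pos : Set
Pos = Fin 2 × ℕ

col : Pos → ℕ
col = proj₂

shift : ℕ → Pos → Pos
shift k (a , x) = a , k + x

shift-shift : ∀ k j p → shift k (shift j p) ≡ shift (j + k) p
shift-shift k j (a , x) = cong (a ,_) (trans (sym (+-assoc k j x)) (cong (_+ x) (+-comm k j)))

shift-injective : ∀ k {p q} → shift k p ≡ shift k q → p ≡ q
shift-injective k {a , x} {b , y} eq = cong₂ _,_ (cong proj₁ eq) (+-cancelˡ-≡ k x y (cong proj₂ eq))

EqualBelow : ℕ → (Pos → Pos) → (Pos → Pos) → Set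
EqualBelow n f g = ∀ p → col p < n → f p ≡ g p

-- The other square of p's domino; junk at columns ≥ w.
partner : ∀ {w} → Tiling w → Pos → Pos
partner [] p = p
partner (vert t) (a , zero) = opposite a , zero
partner (vert t) (a , suc x) = shift 1 (partner t (a , x))
partner (horiz t) (a , zero) = a , 1
partner (horiz t) (a , suc zero) = a , 0
partner (horiz t) (a , suc (suc x)) = shift 2 (partner t (a , x))

LadderAdj : Pos → Pos → Set
LadderAdj (a , x) (b , y) = (b ≡ opposite a × y ≡ x) ⊎ (b ≡ a × (y ≡ suc x ⊎ x ≡ suc y))

LadderAdj-shift : ∀ k {p q} → LadderAdj p q → LadderAdj (shift k p) (shift k q)
LadderAdj-shift k (inj₁ (b≡a′ , y≡x)) = inj₁ (b≡a′ , cong (k +_) y≡x)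
LadderAdj-shift k {a , x} (inj₂ (b≡a , inj₁ y≡1+x)) = inj₂ (b≡a , inj₁ (trans (cong (k +_) y≡1+x) (+-suc k x)))
LadderAdj-shift k {q = b , y} (inj₂ (b≡a , inj₂ x≡1+y)) = inj₂ (b≡a , inj₂ (trans (cong (k +_) x≡1+y) (+-suc k y)))

partner-< : ∀ {w} (t : Tiling w) p → col p < w → col (partner t p) < w
partner-< (vert t) (a , zero) _ = s≤s z≤n
partner-< (vert t) (a , suc x) (s≤s x<w) = s≤s (partner-< t (a , x) x<w)
partner-< (horiz t) (a , zero) _ = s≤s (s≤s z≤n)
partner-< (horiz t) (a , suc zero) _ = s≤s z≤n
partner-< (horiz t) (a , suc (suc x)) (s≤s (s≤s x<w)) = s≤s (s≤s (partner-< t (a , x) x<w))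

partner-involutive : ∀ {w} (t : Tiling w) p → col p < w → partner t (partner t p) ≡ p
partner-involutive (vert t) (a , zero) _ = cong (_, 0) (opposite-involutive a)
partner-involutive (vert t) (a , suc x) (s≤s x<w) = cong (shift 1) (partner-involutive t (a , x) x<w)
partner-involutive (horiz t) (a , zero) _ = refl
partner-involutive (horiz t) (a , suc zero) _ = refl
partner-involutive (horiz t) (a , suc (suc x)) (s≤s (s≤s x<w)) = cong (shift 2) (partner-involutive t (a , x) x<w)

partner-adjacent : ∀ {w} (t : Tiling w) p → col p < w → LadderAdj p (partner t p)
partner-adjacent (vert t) (a , zero) _ = inj₁ (refl , refl)
partner-adjacent (vert t) (a , suc x) (s≤s x<w) = LadderAdj-shift 1 (partner-adjacent t (a , x) x<w)
partner-adjacent (horiz t) (a , zero) _ = inj₂ (refl , inj₁ refl)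
partner-adjacent (horiz t) (a , suc zero) _ = inj₂ (refl , inj₂ refl)
partner-adjacent (horiz t) (a , suc (suc x)) (s≤s (s≤s x<w)) = LadderAdj-shift 2 (partner-adjacent t (a , x) x<w)

partner-injective : ∀ {w} (t u : Tiling w) → EqualBelow w (partner t) (partner u) → t ≡ u
partner-injective [] [] _ = refl
partner-injective (vert t) (vert u) eq =
  cong vert (partner-injective t u λ { (a , x) x<w → shift-injective 1 (eq (a , suc x) (s≤s x<w)) })
partner-injective (horiz t) (horiz u) eq =
  cong horiz (partner-injective t u λ { (a , x) x<w → shift-injective 2 (eq (a , suc (suc x)) (s≤s (s≤s x<w))) })
partner-injective (vert t) (horiz u) eq with () ← eq (zero , 0) (s≤s z≤n)
partner-injective (horiz t) (vert u) eq with () ← eq (zero , 0) (s≤s z≤n)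

-- P₂ □ T n with the T-coordinate read in ℕ

Adjℕ : ℕ → Pos → Pos → Set
Adjℕ n (a , x) (b , y) = (a ≡ b × SymAdj (TEdge n) x y) ⊎ (b ≡ opposite a × y ≡ x)

TEdge-rightward : ∀ {n x y} → SymAdj (TEdge n) x y → 2 ≤ x → x ≤ y → y ≡ suc x
TEdge-rightward (inj₁ (inj₁ (refl , _))) ()
TEdge-rightward (inj₁ (inj₂ (inj₁ (refl , _)))) (s≤s ())
TEdge-rightward (inj₁ (inj₂ (inj₂ (_ , y≡1+x , _)))) _ _ = y≡1+x
TEdge-rightward (inj₂ (inj₁ (refl , refl))) _ ()
TEdge-rightward (inj₂ (inj₂ (inj₁ (refl , refl)))) _ (s≤s ())
TEdge-rightward (inj₂ (inj₂ (inj₂ (_ , refl , _)))) _ 1+y≤y = ⊥-elim (1+n≰n 1+y≤y)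

TEdge-pendant : ∀ {n x y} → SymAdj (TEdge n) x y → x < 2 → y ≡ 2
TEdge-pendant (inj₁ (inj₁ (_ , y≡2))) _ = y≡2
TEdge-pendant (inj₁ (inj₂ (inj₁ (_ , y≡2)))) _ = y≡2
TEdge-pendant (inj₁ (inj₂ (inj₂ (2≤x , _)))) x<2 = ⊥-elim (<⇒≱ x<2 2≤x)
TEdge-pendant (inj₂ (inj₁ (refl , refl))) (s≤s (s≤s ()))
TEdge-pendant (inj₂ (inj₂ (inj₁ (refl , refl)))) (s≤s (s≤s ()))
TEdge-pendant (inj₂ (inj₂ (inj₂ (s≤s (s≤s _) , refl , _)))) (s≤s (s≤s ()))

Adjℕ-rightward : ∀ {n a x} q → Adjℕ n (a , x) q → 2 ≤ x → x ≤ col q → q ≡ (opposite a , x) ⊎ q ≡ (a , suc x)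
Adjℕ-rightward _ (inj₁ (refl , edge)) 2≤x x≤y = inj₂ (cong (_ ,_) (TEdge-rightward edge 2≤x x≤y))
Adjℕ-rightward _ (inj₂ (refl , refl)) _ _ = inj₁ refl

Adjℕ-pendant : ∀ {n a x} q → Adjℕ n (a , x) q → x < 2 → q ≡ (opposite a , x) ⊎ q ≡ (a , 2)
Adjℕ-pendant _ (inj₁ (refl , edge)) x<2 = inj₂ (cong (_ ,_) (TEdge-pendant edge x<2))
Adjℕ-pendant _ (inj₂ (refl , refl)) _ = inj₁ refl

Adjℕ-shift : ∀ {n w} k → 2 ≤ k → k + w ≤ n → ∀ {p q} → col p < w → col q < w →
  LadderAdj p q → Adjℕ n (shift k p) (shift k q)
Adjℕ-shift k _ _ _ _ (inj₁ (refl , refl)) = inj₂ (refl , refl)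
Adjℕ-shift k 2≤k k+w≤n {a , x} {_ , y} _ y<w (inj₂ (refl , inj₁ refl)) =
  inj₁ (refl , inj₁ (inj₂ (inj₂ (≤-trans 2≤k (m≤m+n k x) , +-suc k x , ≤-trans (+-monoʳ-< k y<w) k+w≤n))))
Adjℕ-shift k 2≤k k+w≤n {a , x} {_ , y} x<w _ (inj₂ (refl , inj₂ refl)) =
  inj₁ (refl , inj₂ (inj₂ (inj₂ (≤-trans 2≤k (m≤m+n k y) , +-suc k y , ≤-trans (+-monoʳ-< k x<w) k+w≤n))))

P₂-adjacent : ∀ (a b : Fin 2) → SymAdj P2Edge (toℕ a) (toℕ b) → b ≡ opposite a
P₂-adjacent zero (suc zero) _ = refl
P₂-adjacent (suc zero) zero _ = refl
P₂-adjacent zero zero (inj₁ (_ , ()))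
P₂-adjacent zero zero (inj₂ (_ , ()))
P₂-adjacent (suc zero) (suc zero) (inj₁ (() , _))
P₂-adjacent (suc zero) (suc zero) (inj₂ (() , _))

P₂-adjacent-opposite : ∀ (a : Fin 2) → SymAdj P2Edge (toℕ a) (toℕ (opposite a))
P₂-adjacent-opposite zero = inj₁ (refl , refl)
P₂-adjacent-opposite (suc zero) = inj₂ (refl , refl)

toPos : ∀ {n} → Fin 2 × Fin n → Pos
toPos = map₂ toℕ

CartAdj⇒Adjℕ : ∀ {n} p q → CartAdj P₂ (T n) p q → Adjℕ n (toPos p) (toPos q)
CartAdj⇒Adjℕ _ _ (inj₁ (a≡b , edge)) = inj₁ (a≡b , edge)
CartAdj⇒Adjℕ (a , _) (b , _) (inj₂ (p₂-edge , refl)) = inj₂ (P₂-adjacent a b p₂-edge , refl)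

Adjℕ⇒CartAdj : ∀ {n} p q → Adjℕ n (toPos p) (toPos q) → CartAdj P₂ (T n) p q
Adjℕ⇒CartAdj _ _ (inj₁ (a≡b , edge)) = inj₁ (a≡b , edge)
Adjℕ⇒CartAdj (a , _) _ (inj₂ (refl , y≡x)) = inj₂ (P₂-adjacent-opposite a , sym (toℕ-injective y≡x))

record IsMatchingℕ (n : ℕ) (f : Pos → Pos) : Set where
  field
    bounded    : ∀ p → col p < n → col (f p) < n
    adjacent   : ∀ p → col p < n → Adjℕ n p (f p)
    involutive : ∀ p → col p < n → f (f p) ≡ p

module _ {n : ℕ} .{{_ : NonZero n}} where

  -- Reduction mod n is only a placeholder for columns ≥ n, where the maps below are junk.
  fromPos : Pos → Fin 2 × Fin n
  fromPos = map₂ (_mod n)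

  toPos∘fromPos : ∀ p → col p < n → toPos (fromPos p) ≡ p
  toPos∘fromPos (a , x) x<n = cong (a ,_) (trans (toℕ-fromℕ< _) (m<n⇒m%n≡m x<n))

  fromPos∘toPos : ∀ p → fromPos (toPos p) ≡ p
  fromPos∘toPos (a , x) = cong (a ,_) (toℕ-injective (cong col (toPos∘fromPos (a , toℕ x) (toℕ<n x))))

  lift : (Fin 2 × Fin n → Fin 2 × Fin n) → Pos → Pos
  lift μ = toPos ∘ μ ∘ fromPos

  lower : (Pos → Pos) → Fin 2 × Fin n → Fin 2 × Fin n
  lower f = fromPos ∘ f ∘ toPos

  lower∘lift : ∀ μ p → lower (lift μ) p ≡ μ p
  lower∘lift μ p = trans (fromPos∘toPos _) (cong μ (fromPos∘toPos p))

  lower-cong : ∀ {f g} → EqualBelow n f g → ∀ p → lower f p ≡ lower g p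
  lower-cong f≈g p = cong fromPos (f≈g (toPos p) (toℕ<n (proj₂ p)))

  lift-matching : ∀ {μ} → IsPartnerMap P₂ (T n) μ → IsMatchingℕ n (lift μ)
  lift-matching {μ} partner = record
    { bounded    = λ p _ → toℕ<n (proj₂ (μ (fromPos p)))
    ; adjacent   = λ p p<n → subst (λ q → Adjℕ n q (lift μ p)) (toPos∘fromPos p p<n)
                     (CartAdj⇒Adjℕ (fromPos p) _ (proj₁ (partner (fromPos p))))
    ; involutive = λ p p<n → begin
        toPos (μ (fromPos (toPos (μ (fromPos p)))))  ≡⟨ cong (toPos ∘ μ) (fromPos∘toPos _) ⟩
        toPos (μ (μ (fromPos p)))                    ≡⟨ cong toPos (proj₂ (partner (fromPos p))) ⟩
        toPos (fromPos p)                            ≡⟨ toPos∘fromPos p p<n ⟩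
        p                                            ∎
    }

  module _ {f : Pos → Pos} (matching : IsMatchingℕ n f) where
    open IsMatchingℕ matching

    private
      toPos∘fromPos∘f : ∀ p → toPos (fromPos (f (toPos p))) ≡ f (toPos p)
      toPos∘fromPos∘f p = toPos∘fromPos (f (toPos p)) (bounded (toPos p) (toℕ<n (proj₂ p)))

    lower-matching : IsPartnerMap P₂ (T n) (lower f)
    lower-matching p =
      Adjℕ⇒CartAdj p _ (subst (Adjℕ n (toPos p)) (sym (toPos∘fromPos∘f p)) (adjacent (toPos p) (toℕ<n (proj₂ p)))) ,
      (begin
        fromPos (f (toPos (fromPos (f (toPos p)))))  ≡⟨ cong (fromPos ∘ f) (toPos∘fromPos∘f p) ⟩
        fromPos (f (f (toPos p)))                    ≡⟨ cong fromPos (involutive (toPos p) (toℕ<n (proj₂ p))) ⟩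
        fromPos (toPos p)                            ≡⟨ fromPos∘toPos p ⟩
        p                                            ∎)

    f≡toPos∘lower : ∀ p → col p < n → f p ≡ toPos (lower f (fromPos p))
    f≡toPos∘lower p p<n = begin
      f p                                      ≡⟨ toPos∘fromPos (f p) (bounded p p<n) ⟨
      toPos (fromPos (f p))                    ≡⟨ cong (toPos ∘ fromPos ∘ f) (toPos∘fromPos p p<n) ⟨
      toPos (fromPos (f (toPos (fromPos p))))  ∎

  lower-injective : ∀ {f g} → IsMatchingℕ n f → IsMatchingℕ n g →
    (∀ p → lower f p ≡ lower g p) → EqualBelow n f g
  lower-injective f-matching g-matching lf≗lg p p<n =
    trans (f≡toPos∘lower f-matching p p<n)
      (trans (cong toPos (lf≗lg (fromPos p))) (sym (f≡toPos∘lower g-matching p p<n)))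

-- Columns 0 and 1 are the pendant ones. Either both are matched vertically and a tiling
-- covers columns 2, 3, …; or column i is matched horizontally into column 2 (`armᵢ`),
-- the other pendant column vertically, and a tiling covers columns 3, 4, ….
data Code (m : ℕ) : Set where
  rungs : Tiling (suc m) → Code m
  arm₀  : Tiling m → Code m
  arm₁  : Tiling m → Code m

codeMap : ∀ {m} → Code m → Pos → Pos
codeMap (rungs t) (a , 0) = opposite a , 0
codeMap (rungs t) (a , 1) = opposite a , 1
codeMap (rungs t) (a , suc (suc x)) = shift 2 (partner t (a , x))
codeMap (arm₀ t) (a , 0) = a , 2
codeMap (arm₀ t) (a , 1) = opposite a , 1
codeMap (arm₀ t) (a , 2) = a , 0
codeMap (arm₀ t) (a , suc (suc (suc x))) = shift 3 (partner t (a , x))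
codeMap (arm₁ t) (a , 0) = opposite a , 0
codeMap (arm₁ t) (a , 1) = a , 2
codeMap (arm₁ t) (a , 2) = a , 1
codeMap (arm₁ t) (a , suc (suc (suc x))) = shift 3 (partner t (a , x))

codeMap-< : ∀ {m} (c : Code m) p → col p < 3 + m → col (codeMap c p) < 3 + m
codeMap-< (rungs t) (a , 0) _ = s≤s z≤n
codeMap-< (rungs t) (a , 1) _ = s≤s (s≤s z≤n)
codeMap-< (rungs t) (a , suc (suc x)) (s≤s (s≤s x<)) = s≤s (s≤s (partner-< t (a , x) x<))
codeMap-< (arm₀ t) (a , 0) _ = s≤s (s≤s (s≤s z≤n))
codeMap-< (arm₀ t) (a , 1) _ = s≤s (s≤s z≤n)
codeMap-< (arm₀ t) (a , 2) _ = s≤s z≤n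
codeMap-< (arm₀ t) (a , suc (suc (suc x))) (s≤s (s≤s (s≤s x<))) = s≤s (s≤s (s≤s (partner-< t (a , x) x<)))
codeMap-< (arm₁ t) (a , 0) _ = s≤s z≤n
codeMap-< (arm₁ t) (a , 1) _ = s≤s (s≤s (s≤s z≤n))
codeMap-< (arm₁ t) (a , 2) _ = s≤s (s≤s z≤n)
codeMap-< (arm₁ t) (a , suc (suc (suc x))) (s≤s (s≤s (s≤s x<))) = s≤s (s≤s (s≤s (partner-< t (a , x) x<)))

codeMap-involutive : ∀ {m} (c : Code m) p → col p < 3 + m → codeMap c (codeMap c p) ≡ p
codeMap-involutive (rungs t) (a , 0) _ = cong (_, 0) (opposite-involutive a)
codeMap-involutive (rungs t) (a , 1) _ = cong (_, 1) (opposite-involutive a)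
codeMap-involutive (rungs t) (a , suc (suc x)) (s≤s (s≤s x<)) = cong (shift 2) (partner-involutive t (a , x) x<)
codeMap-involutive (arm₀ t) (a , 0) _ = refl
codeMap-involutive (arm₀ t) (a , 1) _ = cong (_, 1) (opposite-involutive a)
codeMap-involutive (arm₀ t) (a , 2) _ = refl
codeMap-involutive (arm₀ t) (a , suc (suc (suc x))) (s≤s (s≤s (s≤s x<))) =
  cong (shift 3) (partner-involutive t (a , x) x<)
codeMap-involutive (arm₁ t) (a , 0) _ = cong (_, 0) (opposite-involutive a)
codeMap-involutive (arm₁ t) (a , 1) _ = refl
codeMap-involutive (arm₁ t) (a , 2) _ = refl
codeMap-involutive (arm₁ t) (a , suc (suc (suc x))) (s≤s (s≤s (s≤s x<))) =
  cong (shift 3) (partner-involutive t (a , x) x<)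

codeMap-adjacent : ∀ {m} (c : Code m) p → col p < 3 + m → Adjℕ (3 + m) p (codeMap c p)
codeMap-adjacent (rungs t) (a , 0) _ = inj₂ (refl , refl)
codeMap-adjacent (rungs t) (a , 1) _ = inj₂ (refl , refl)
codeMap-adjacent (rungs t) (a , suc (suc x)) (s≤s (s≤s x<)) =
  Adjℕ-shift 2 ≤-refl ≤-refl x< (partner-< t (a , x) x<) (partner-adjacent t (a , x) x<)
codeMap-adjacent (arm₀ t) (a , 0) _ = inj₁ (refl , inj₁ (inj₁ (refl , refl)))
codeMap-adjacent (arm₀ t) (a , 1) _ = inj₂ (refl , refl)
codeMap-adjacent (arm₀ t) (a , 2) _ = inj₁ (refl , inj₂ (inj₁ (refl , refl)))
codeMap-adjacent (arm₀ t) (a , suc (suc (suc x))) (s≤s (s≤s (s≤s x<))) =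
  Adjℕ-shift 3 (s≤s (s≤s z≤n)) ≤-refl x< (partner-< t (a , x) x<) (partner-adjacent t (a , x) x<)
codeMap-adjacent (arm₁ t) (a , 0) _ = inj₂ (refl , refl)
codeMap-adjacent (arm₁ t) (a , 1) _ = inj₁ (refl , inj₁ (inj₂ (inj₁ (refl , refl))))
codeMap-adjacent (arm₁ t) (a , 2) _ = inj₁ (refl , inj₂ (inj₂ (inj₁ (refl , refl))))
codeMap-adjacent (arm₁ t) (a , suc (suc (suc x))) (s≤s (s≤s (s≤s x<))) =
  Adjℕ-shift 3 (s≤s (s≤s z≤n)) ≤-refl x< (partner-< t (a , x) x<) (partner-adjacent t (a , x) x<)

codeMap-matching : ∀ {m} (c : Code m) → IsMatchingℕ (3 + m) (codeMap c)
codeMap-matching c = record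
  { bounded = codeMap-< c ; adjacent = codeMap-adjacent c ; involutive = codeMap-involutive c }

codeMap-injective : ∀ {m} (c c′ : Code m) → EqualBelow (3 + m) (codeMap c) (codeMap c′) → c ≡ c′
codeMap-injective (rungs t) (rungs u) eq =
  cong rungs (partner-injective t u λ { (a , x) x< → shift-injective 2 (eq (a , 2 + x) (s≤s (s≤s x<))) })
codeMap-injective (arm₀ t) (arm₀ u) eq =
  cong arm₀ (partner-injective t u λ { (a , x) x< → shift-injective 3 (eq (a , 3 + x) (s≤s (s≤s (s≤s x<)))) })
codeMap-injective (arm₁ t) (arm₁ u) eq =
  cong arm₁ (partner-injective t u λ { (a , x) x< → shift-injective 3 (eq (a , 3 + x) (s≤s (s≤s (s≤s x<)))) })
codeMap-injective (rungs _) (arm₀ _) eq with () ← eq (zero , 0) (s≤s z≤n)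
codeMap-injective (rungs _) (arm₁ _) eq with () ← eq (zero , 1) (s≤s (s≤s z≤n))
codeMap-injective (arm₀ _) (rungs _) eq with () ← eq (zero , 0) (s≤s z≤n)
codeMap-injective (arm₀ _) (arm₁ _) eq with () ← eq (zero , 0) (s≤s z≤n)
codeMap-injective (arm₁ _) (rungs _) eq with () ← eq (zero , 1) (s≤s (s≤s z≤n))
codeMap-injective (arm₁ _) (arm₀ _) eq with () ← eq (zero , 0) (s≤s z≤n)

allCodes : ∀ m → List (Code m)
allCodes m = map rungs (allTilings (suc m)) ++ map arm₀ (allTilings m) ++ map arm₁ (allTilings m)

∈-allCodes : ∀ {m} (c : Code m) → c ∈ allCodes m
∈-allCodes (rungs t) = ∈-++⁺ˡ (∈-map⁺ rungs (∈-allTilings t))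
∈-allCodes {m} (arm₀ t) = ∈-++⁺ʳ (map rungs (allTilings (suc m))) (∈-++⁺ˡ (∈-map⁺ arm₀ (∈-allTilings t)))
∈-allCodes {m} (arm₁ t) =
  ∈-++⁺ʳ (map rungs (allTilings (suc m))) (∈-++⁺ʳ (map arm₀ (allTilings m)) (∈-map⁺ arm₁ (∈-allTilings t)))

allCodes-unique : ∀ m → Unique (allCodes m)
allCodes-unique m =
  Unique.++⁺ (Unique.map⁺ (λ { refl → refl }) (allTilings-unique (suc m)))
    (Unique.++⁺ (Unique.map⁺ (λ { refl → refl }) (allTilings-unique m))
                (Unique.map⁺ (λ { refl → refl }) (allTilings-unique m))
                (map-disjoint λ _ _ ()))
    (++-disjointʳ {ys = map arm₀ (allTilings m)} (map-disjoint λ _ _ ()) (map-disjoint λ _ _ ()))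

length-allCodes : ∀ m → length (allCodes m) ≡ lucas (2 + m)
length-allCodes m = begin
  length (map rungs A₁ ++ map arm₀ A₀ ++ map arm₁ A₀)
    ≡⟨ length-++ (map rungs A₁) ⟩
  length (map rungs A₁) + length (map arm₀ A₀ ++ map arm₁ A₀)
    ≡⟨ cong (length (map rungs A₁) +_) (length-++ (map arm₀ A₀)) ⟩
  length (map rungs A₁) + (length (map arm₀ A₀) + length (map arm₁ A₀))
    ≡⟨ cong₂ _+_ (length-map rungs A₁) (cong₂ _+_ (length-map arm₀ A₀) (length-map arm₁ A₀)) ⟩
  length A₁ + (length A₀ + length A₀)
    ≡⟨ cong₂ _+_ (length-allTilings (suc m)) (cong (λ k → k + k) (length-allTilings m)) ⟩
  fib (2 + m) + (fib (suc m) + fib (suc m))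
    ≡⟨ cong (λ k → fib (2 + m) + (fib (suc m) + k)) (sym (+-identityʳ (fib (suc m)))) ⟩
  fib (2 + m) + 2 * fib (suc m)
    ≡⟨ sym (lucas-suc (suc m)) ⟩
  lucas (2 + m) ∎
  where
    A₁ = allTilings (suc m)
    A₀ = allTilings m

-- Every matching has a code

module _ {m : ℕ} {f : Pos → Pos} (matching : IsMatchingℕ (3 + m) f) where
  open IsMatchingℕ matching

  -- Once the columns below k ≥ 2 are matched among themselves, column k can only be matched
  -- vertically or into column k + 1.
  Closed : ℕ → Set
  Closed k = ∀ p → col p < k → col (f p) < k

  Vertical : ℕ → Set
  Vertical x = ∀ a → f (a , x) ≡ (opposite a , x)

  Horizontal : ℕ → ℕ → Set
  Horizontal x y = ∀ a → f (a , x) ≡ (a , y)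

  closed-≤ : ∀ {k} → Closed k → ∀ p → col p < 3 + m → k ≤ col p → k ≤ col (f p)
  closed-≤ {k} closed p p< k≤p =
    ≮⇒≥ λ fp<k → ≤⇒≯ k≤p (subst (λ q → col q < k) (involutive p p<) (closed (f p) fp<k))

  horizontal-back : ∀ {x y} → x < 3 + m → Horizontal x y → Horizontal y x
  horizontal-back x< h a = trans (cong f (sym (h a))) (involutive (a , _) x<)

  -- If one row of a column were matched vertically, it would take the other row.
  column-uniform : ∀ {x} y → x < 3 + m →
    (∀ a → f (a , x) ≡ (opposite a , x) ⊎ f (a , x) ≡ (a , y)) → Vertical x ⊎ Horizontal x y
  column-uniform {x} y x< moves with moves zero | moves (suc zero)
  ... | inj₁ v₀ | inj₁ v₁ = inj₁ λ { zero → v₀ ; (suc zero) → v₁ }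
  ... | inj₂ h₀ | inj₂ h₁ = inj₂ λ { zero → h₀ ; (suc zero) → h₁ }
  ... | inj₁ v₀ | inj₂ h₁ with () ← trans (sym h₁) (trans (cong f (sym v₀)) (involutive (zero , x) x<))
  ... | inj₂ h₀ | inj₁ v₁ with () ← trans (sym h₀) (trans (cong f (sym v₁)) (involutive (suc zero , x) x<))

  closed-vertical : ∀ {k} → Closed k → Vertical k → Closed (suc k)
  closed-vertical closed vertical (a , x) x<1+k with m<1+n⇒m<n∨m≡n x<1+k
  ... | inj₁ x<k = m<n⇒m<1+n (closed (a , x) x<k)
  ... | inj₂ refl rewrite vertical a = n<1+n x

  closed-horizontal : ∀ {k} → k < 3 + m → Closed k → Horizontal k (suc k) → Closed (2 + k)
  closed-horizontal k< closed h (a , x) x<2+k with m<1+n⇒m<n∨m≡n x<2+k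
  ... | inj₂ refl rewrite horizontal-back k< h a = m<n⇒m<1+n (n<1+n _)
  ... | inj₁ x<1+k with m<1+n⇒m<n∨m≡n x<1+k
  ...   | inj₁ x<k = m<n⇒m<1+n (m<n⇒m<1+n (closed (a , x) x<k))
  ...   | inj₂ refl rewrite h a = n<1+n _

  shifted-agreement : ∀ {w} k j (t : Tiling w) → EqualBelow w (f ∘ shift (j + k)) (shift (j + k) ∘ partner t) →
    ∀ p → col p < w → f (shift k (shift j p)) ≡ shift k (shift j (partner t p))
  shifted-agreement k j t agree p p<w = begin
    f (shift k (shift j p))           ≡⟨ cong f (shift-shift k j p) ⟩
    f (shift (j + k) p)               ≡⟨ agree p p<w ⟩
    shift (j + k) (partner t p)       ≡⟨ shift-shift k j (partner t p) ⟨
    shift k (shift j (partner t p))   ∎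

  extend-vertical : ∀ {k w} {t : Tiling w} → Vertical k →
    EqualBelow w (f ∘ shift (suc k)) (shift (suc k) ∘ partner t) →
    EqualBelow (suc w) (f ∘ shift k) (shift k ∘ partner (vert t))
  extend-vertical {k} vertical _ (a , zero) _ =
    subst (λ y → f (a , y) ≡ (opposite a , y)) (sym (+-identityʳ k)) (vertical a)
  extend-vertical {k} {t = t} _ agree (a , suc x) (s≤s x<w) = shifted-agreement k 1 t agree (a , x) x<w

  extend-horizontal : ∀ {k w} {t : Tiling w} → k < 3 + m → Horizontal k (suc k) →
    EqualBelow w (f ∘ shift (2 + k)) (shift (2 + k) ∘ partner t) →
    EqualBelow (2 + w) (f ∘ shift k) (shift k ∘ partner (horiz t))
  extend-horizontal {k} _ h _ (a , 0) _ =
    trans (cong (λ y → f (a , y)) (+-identityʳ k)) (trans (h a) (cong (a ,_) (+-comm 1 k)))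
  extend-horizontal {k} k< h _ (a , 1) _ =
    trans (cong (λ y → f (a , y)) (+-comm k 1))
      (trans (horizontal-back k< h a) (cong (a ,_) (sym (+-identityʳ k))))
  extend-horizontal {k} {t = t} _ _ agree (a , suc (suc x)) (s≤s (s≤s x<w)) =
    shifted-agreement k 2 t agree (a , x) x<w

  column-< : ∀ {k w} → k + suc w ≡ 3 + m → k < 3 + m
  column-< {k} k+w≡ = subst (k <_) k+w≡ (m<m+n k (s≤s z≤n))

  decode-ladder : ∀ w k → k + w ≡ 3 + m → 2 ≤ k → Closed k →
    Σ (Tiling w) λ t → EqualBelow w (f ∘ shift k) (shift k ∘ partner t)

  decode-column : ∀ w k → k + suc w ≡ 3 + m → 2 ≤ k → Closed k → Vertical k ⊎ Horizontal k (suc k) →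
    Σ (Tiling (suc w)) λ t → EqualBelow (suc w) (f ∘ shift k) (shift k ∘ partner t)

  decode-ladder zero _ _ _ _ = [] , λ _ ()
  decode-ladder (suc w) k k+w≡ 2≤k closed =
    decode-column w k k+w≡ 2≤k closed (column-uniform (suc k) (column-< k+w≡) moves)
    where
      moves : ∀ a → f (a , k) ≡ (opposite a , k) ⊎ f (a , k) ≡ (a , suc k)
      moves a = Adjℕ-rightward (f (a , k)) (adjacent (a , k) (column-< k+w≡)) 2≤k
                  (closed-≤ closed (a , k) (column-< k+w≡) ≤-refl)

  decode-column w k k+w≡ 2≤k closed (inj₁ vertical) =
    let t , agree = decode-ladder w (suc k) (trans (sym (+-suc k w)) k+w≡) (m≤n⇒m≤1+n 2≤k)
                      (closed-vertical closed vertical)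
    in vert t , extend-vertical vertical agree
  decode-column zero k k+1≡ _ _ (inj₂ h) =  -- a horizontal domino cannot start in the last column
    ⊥-elim (<-irrefl (trans (+-comm 1 k) k+1≡)
      (subst (λ q → col q < 3 + m) (h zero) (bounded (zero , k) (column-< k+1≡))))
  decode-column (suc w) k k+w≡ 2≤k closed (inj₂ h) =
    let t , agree = decode-ladder w (2 + k) (trans (sym (trans (+-suc k (suc w)) (cong suc (+-suc k w)))) k+w≡)
                      (m≤n⇒m≤1+n (m≤n⇒m≤1+n 2≤k)) (closed-horizontal (column-< k+w≡) closed h)
    in horiz t , extend-horizontal (column-< k+w≡) h agree

  pendant-column : ∀ x → x < 2 → Vertical x ⊎ Horizontal x 2
  pendant-column x x<2 =
    column-uniform 2 x< λ a → Adjℕ-pendant (f (a , x)) (adjacent (a , x) x<) x<2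
    where
      x< : x < 3 + m
      x< = ≤-trans x<2 (s≤s (s≤s z≤n))

  decode-rungs : Vertical 0 → Vertical 1 → Σ (Code m) λ c → EqualBelow (3 + m) f (codeMap c)
  decode-rungs v₀ v₁ = rungs (proj₁ ladder) , agree
    where
      ladder = decode-ladder (suc m) 2 refl ≤-refl (closed-vertical (closed-vertical (λ _ ()) v₀) v₁)
      agree : EqualBelow (3 + m) f (codeMap (rungs (proj₁ ladder)))
      agree (a , 0) _ = v₀ a
      agree (a , 1) _ = v₁ a
      agree (a , suc (suc x)) (s≤s (s≤s x<)) = proj₂ ladder (a , x) x<

  decode-arm₀ : Horizontal 0 2 → Vertical 1 → Σ (Code m) λ c → EqualBelow (3 + m) f (codeMap c)
  decode-arm₀ h₀ v₁ = arm₀ (proj₁ ladder) , agree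
    where
      h₀′ = horizontal-back (s≤s z≤n) h₀
      closed₃ : Closed 3
      closed₃ (a , 0) _ rewrite h₀ a = n<1+n 2
      closed₃ (a , 1) _ rewrite v₁ a = s≤s (s≤s z≤n)
      closed₃ (a , 2) _ rewrite h₀′ a = s≤s z≤n
      closed₃ (a , suc (suc (suc x))) (s≤s (s≤s (s≤s ())))
      ladder = decode-ladder m 3 refl (s≤s (s≤s z≤n)) closed₃
      agree : EqualBelow (3 + m) f (codeMap (arm₀ (proj₁ ladder)))
      agree (a , 0) _ = h₀ a
      agree (a , 1) _ = v₁ a
      agree (a , 2) _ = h₀′ a
      agree (a , suc (suc (suc x))) (s≤s (s≤s (s≤s x<))) = proj₂ ladder (a , x) x<

  decode-arm₁ : Vertical 0 → Horizontal 1 2 → Σ (Code m) λ c → EqualBelow (3 + m) f (codeMap c)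
  decode-arm₁ v₀ h₁ = arm₁ (proj₁ ladder) , agree
    where
      h₁′ = horizontal-back (s≤s (s≤s z≤n)) h₁
      closed₃ : Closed 3
      closed₃ (a , 0) _ rewrite v₀ a = s≤s z≤n
      closed₃ (a , 1) _ rewrite h₁ a = n<1+n 2
      closed₃ (a , 2) _ rewrite h₁′ a = s≤s (s≤s z≤n)
      closed₃ (a , suc (suc (suc x))) (s≤s (s≤s (s≤s ())))
      ladder = decode-ladder m 3 refl (s≤s (s≤s z≤n)) closed₃
      agree : EqualBelow (3 + m) f (codeMap (arm₁ (proj₁ ladder)))
      agree (a , 0) _ = v₀ a
      agree (a , 1) _ = h₁ a
      agree (a , 2) _ = h₁′ a
      agree (a , suc (suc (suc x))) (s≤s (s≤s (s≤s x<))) = proj₂ ladder (a , x) x<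

  matching-code : Σ (Code m) λ c → EqualBelow (3 + m) f (codeMap c)
  matching-code with pendant-column 0 (s≤s z≤n) | pendant-column 1 (s≤s (s≤s z≤n))
  ... | inj₁ v₀ | inj₁ v₁ = decode-rungs v₀ v₁
  ... | inj₂ h₀ | inj₁ v₁ = decode-arm₀ h₀ v₁
  ... | inj₁ v₀ | inj₂ h₁ = decode-arm₁ v₀ h₁
  ... | inj₂ h₀ | inj₂ h₁
    with () ← trans (sym (horizontal-back (s≤s z≤n) h₀ zero)) (horizontal-back (s≤s (s≤s z≤n)) h₁ zero)

matchingVec : ∀ {m} → Code m → Vec (Fin (2 * (3 + m))) (2 * (3 + m))
matchingVec {m} c = partnerVec (lower {3 + m} (codeMap c))

matchingVec-perfect : ∀ {m} (c : Code m) → IsPerfectMatching (P₂ □ T (3 + m)) (matchingVec c)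
matchingVec-perfect c = partnerVec-isPerfectMatching P₂ (T _) (lower-matching (codeMap-matching c))

matchingVec-injective : ∀ {m} {c c′ : Code m} → matchingVec c ≡ matchingVec c′ → c ≡ c′
matchingVec-injective {m} {c} {c′} eq =
  codeMap-injective c c′ (lower-injective (codeMap-matching c) (codeMap-matching c′) λ p → begin
    lower (codeMap c) p                          ≡⟨ partnerMap∘partnerVec (lower (codeMap c)) p ⟨
    partnerMap {2} {3 + m} (matchingVec c) p     ≡⟨ cong (λ v → partnerMap v p) eq ⟩
    partnerMap {2} {3 + m} (matchingVec c′) p    ≡⟨ partnerMap∘partnerVec (lower (codeMap c′)) p ⟩
    lower (codeMap c′) p                         ∎)

perfect⇒matchingVec : ∀ {m} v → IsPerfectMatching (P₂ □ T (3 + m)) v → Σ (Code m) λ c → v ≡ matchingVec c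
perfect⇒matchingVec {m} v perfect = proj₁ code , (begin
  v                                ≡⟨ partnerVec∘partnerMap {2} {3 + m} v ⟨
  partnerVec μ                     ≡⟨ partnerVec-cong (lower∘lift μ) ⟨
  partnerVec (lower (lift μ))      ≡⟨ partnerVec-cong (lower-cong (proj₂ code)) ⟩
  matchingVec (proj₁ code)         ∎)
  where
    μ : Fin 2 × Fin (3 + m) → Fin 2 × Fin (3 + m)
    μ = partnerMap v
    code = matching-code (lift-matching {μ = μ} (partnerMap-isPartnerMap P₂ (T (3 + m)) {v} perfect))

theorem5p9 : (n : ℕ) → 3 ≤ n → lucas (n ∸ 1) ≡ numPerfectMatchings (P₂ □ T n)
theorem5p9 (suc (suc (suc m))) (s≤s (s≤s (s≤s _))) = begin
  lucas (2 + m)             ≡⟨ length-allCodes m ⟨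
  length (allCodes m)       ≡⟨ length-map matchingVec (allCodes m) ⟨
  length matchingVecs       ≡⟨ length-filter≡length (isPM? G) {xs = allVecs V V} {ys = matchingVecs}
                                 (allVecs-unique V V) (∈-allVecs V V)
                                 (Unique.map⁺ matchingVec-injective (allCodes-unique m))
                                 perfect⇒∈ ∈⇒perfect ⟨
  numPerfectMatchings G     ∎
  where
    G = P₂ □ T (3 + m)
    V = 2 * (3 + m)
    matchingVecs = map matchingVec (allCodes m)
    perfect⇒∈ : ∀ v → IsPerfectMatching G v → v ∈ matchingVecs
    perfect⇒∈ v perfect =
      let c , v≡ = perfect⇒matchingVec v perfect
      in subst (_∈ matchingVecs) (sym v≡) (∈-map⁺ matchingVec (∈-allCodes c))
    ∈⇒perfect : ∀ v → v ∈ matchingVecs → IsPerfectMatching G v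
    ∈⇒perfect v v∈ =
      let c , _ , v≡ = ∈-map⁻ matchingVec v∈
      in subst (IsPerfectMatching G) (sym v≡) (matchingVec-perfect c)
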